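{- For every integer $d\ge 3$, the total mutual-visibility number of the cube-connected cycle satisfies $\mu_t(\mathit{CCC}_d)=0$.
   Context: For a connected graph $G$ and $X\subseteq V(G)$, two vertices $x,y\in V(G)$ are $X$-visible if there is a shortest $x,y$-path none of whose internal vertices lies in $X$. $X$ is a total mutual-visibility set of $G$ if every two vertices of $V(G)$ are $X$-visible; $\mu_t(G)$ is the maximum cardinality of a total mutual-visibility set of $G$. For $d\ge 3$, the cube-connected cycle $\mathit{CCC}_d$ has vertex set $\{[\ell,x] : \ell\in\{0,\dots,d-1\},\ x\in\{0,1\}^d\}$, where bit positions of $x$ are numbered $0,\dots,d-1$ from the left; $[\ell,x]$ and $[\ell',x']$ are adjacent if and only if either $x=x'$ and $\ell'\equiv \ell\pm 1 \pmod d$, or $\ell=\ell'$ and $x'$ is obtained from $x$ by complementing the bit in position $\ell$. -}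

module Defs where

open import Data.Nat using (ℕ; zero; suc; _≤_)
open import Data.Fin using (Fin; toℕ)
open import Data.Bool using (Bool; not)
open import Data.Vec using (Vec; updateAt)
open import Data.List using (List; []; _∷_; length)
open import Data.List.Membership.Propositional using (_∈_)
open import Data.List.Relation.Unary.Unique.Propositional using (Unique)
open import Data.List.Relation.Unary.All using (All)
open import Data.Product using (_×_; Σ)
open import Data.Sum using (_⊎_)
open import Relation.Binary.PropositionalEquality using (_≡_)
open import Relation.Nullary using (¬_)

module _ {V : Set} (E : V → V → Set) where

  -- Walk x y n I : a walk from x to y with n edges whose list of
  -- internal vertices (all vertices strictly between the ends) is I.
  data Walk : V → V → ℕ → List V → Set where
    trivial : ∀ {x} → Walk x x 0 []
    edge    : ∀ {x y} → E x y → Walk x y 1 []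
    cons    : ∀ {x z y n I} → E x z → Walk z y (suc n) I →
              Walk x y (suc (suc n)) (z ∷ I)

  ShortestPath : V → V → ℕ → List V → Set
  ShortestPath x y n I =
    Walk x y n I × (∀ m J → Walk x y m J → n ≤ m)

  Visible : List V → V → V → Set
  Visible X x y =
    Σ ℕ λ n → Σ (List V) λ I → ShortestPath x y n I × All (λ v → ¬ (v ∈ X)) I

  IsTotalMutualVisibilitySet : List V → Set
  IsTotalMutualVisibilitySet X = ∀ x y → Visible X x y

  -- μ_t(G) = k : k is the maximum cardinality of a total mutual-visibility
  -- set (finite sets represented by duplicate-free lists; |X| = length).
  MuT≡ : ℕ → Set
  MuT≡ k =
    (Σ (List V) λ X → Unique X × IsTotalMutualVisibilitySet X × length X ≡ k)
    × (∀ X → Unique X → IsTotalMutualVisibilitySet X → length X ≤ k)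

-- vertex [ℓ , x]; bit positions of x are Vec indices 0..d-1 from the left
CCCVertex : ℕ → Set
CCCVertex d = Fin d × Vec Bool d

SuccMod : (d : ℕ) → Fin d → Fin d → Set
SuccMod d ℓ ℓ' = (toℕ ℓ' ≡ suc (toℕ ℓ)) ⊎ (suc (toℕ ℓ) ≡ d × toℕ ℓ' ≡ 0)

data CCCAdj (d : ℕ) : CCCVertex d → CCCVertex d → Set where
  cyc+  : ∀ {ℓ ℓ' x} → SuccMod d ℓ ℓ' → CCCAdj d (ℓ Data.Product., x) (ℓ' Data.Product., x)
  cyc-  : ∀ {ℓ ℓ' x} → SuccMod d ℓ' ℓ → CCCAdj d (ℓ Data.Product., x) (ℓ' Data.Product., x)
  cube  : ∀ {ℓ x} → CCCAdj d (ℓ Data.Product., x) (ℓ Data.Product., updateAt x ℓ not)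

-- Write x ⊕ e_ℓ for x with bit ℓ flipped. Every vertex v = [ℓ, x] of CCC_d is the unique
-- common neighbour of the non-adjacent vertices [ℓ, x ⊕ e_ℓ] and [ℓ + 1, x], so the only
-- shortest path between them runs through v: no nonempty set of vertices is a total
-- mutual-visibility set. The empty set is one because CCC_d is connected and, being
-- finite, has shortest paths.
module Submission where

open import Defs
open import Level using (0ℓ)
open import Data.Nat using (ℕ; zero; suc; _≤_; _<_; z≤n; s≤s; _<?_) renaming (_≟_ to _≟ℕ_)
open import Data.Nat.Properties using (anyUpTo?; ≮⇒≥; ≤-antisym; 1+n≢n)
open import Data.Nat.Induction using (<-rec)
open import Data.Fin using (Fin; toℕ; fromℕ<) renaming (zero to fzero; suc to fsuc)
open import Data.Fin.Properties using (toℕ-fromℕ<; toℕ<n; toℕ-inject₁) renaming (any? to anyFin?; _≟_ to _≟Fin_)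
open import Data.Fin.Induction using (<-weakInduction)
open import Data.Bool using (Bool; true; false; not)
open import Data.Bool.Properties using (not-involutive; not-¬) renaming (_≟_ to _≟Bool_)
open import Data.Vec using (Vec; []; _∷_; updateAt; lookup)
open import Data.Vec.Properties using (updateAt-updateAt; updateAt-id-local; lookup∘updateAt; lookup∘updateAt′) renaming (≡-dec to ≡-decVec)
open import Data.List using ([]; _∷_)
open import Data.List.Membership.Propositional using (_∈_)
open import Data.List.Relation.Unary.All using (All; []; _∷_; universal)
open import Data.List.Relation.Unary.Any using (here)
open import Data.List.Relation.Unary.AllPairs using ([])
open import Data.Empty using (⊥-elim)
open import Data.Product using (_×_; _,_; proj₂; ∃; ∃₂)
open import Data.Product.Properties using () renaming (≡-dec to ≡-dec×)
open import Data.Sum using (_⊎_; inj₁; inj₂; [_,_])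
open import Function.Base using (_∘_)
open import Function.Bundles using (_⇔_; mk⇔; Equivalence)
open import Function.Properties.Equivalence using () renaming (sym to ⇔-sym)
open import Relation.Binary.Core using (Rel)
open import Relation.Binary.Definitions using (Decidable; DecidableEquality; Sym)
open import Relation.Binary.Construct.Closure.ReflexiveTransitive using (Star; ε; _◅_; _◅◅_; gmap; kleisliStar; reverse)
open import Relation.Binary.PropositionalEquality using (_≡_; _≢_; refl; sym; trans; cong; subst; module ≡-Reasoning)
open import Relation.Nullary using (Dec; yes; no; ¬_)
open import Relation.Nullary.Decidable using (_×-dec_; _⊎-dec_) renaming (map to mapDec)
open import Relation.Unary using (Pred) renaming (Decidable to DecidablePred)

least-witness : {P : Pred ℕ 0ℓ} → DecidablePred P →
                ∀ {n} → P n → ∃ λ m → P m × (∀ {k} → P k → m ≤ k)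
least-witness {P} P? {n} = <-rec (λ n → P n → Least) search n
  where
  Least : Set
  Least = ∃ λ m → P m × (∀ {k} → P k → m ≤ k)

  search : ∀ n → (∀ {m} → m < n → P m → Least) → P n → Least
  search n smaller Pn with anyUpTo? P? n
  ... | yes (m , m<n , Pm) = smaller m<n Pm
  ... | no ∄m<n = n , Pn , λ {k} Pk → ≮⇒≥ λ k<n → ∄m<n (k , k<n , Pk)

Searchable : Set → Set₁
Searchable A = {P : Pred A 0ℓ} → DecidablePred P → Dec (∃ P)

Fin-searchable : ∀ {n} → Searchable (Fin n)
Fin-searchable = anyFin?

Bool-searchable : Searchable Bool
Bool-searchable P? =
  mapDec (mk⇔ [ (true ,_) , (false ,_) ] λ { (true , p) → inj₁ p ; (false , p) → inj₂ p })
         (P? true ⊎-dec P? false)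

Vec-searchable : ∀ {A n} → Searchable A → Searchable (Vec A n)
Vec-searchable {n = zero} _ P? = mapDec (mk⇔ ([] ,_) λ { ([] , p) → p }) (P? [])
Vec-searchable {n = suc n} search P? =
  mapDec (mk⇔ (λ (a , as , p) → a ∷ as , p) λ { (a ∷ as , p) → a , as , p })
         (search λ a → Vec-searchable search λ as → P? (a ∷ as))

×-searchable : ∀ {A B} → Searchable A → Searchable B → Searchable (A × B)
×-searchable searchA searchB {P} P? =
  mapDec (mk⇔ (λ (a , b , p) → (a , b) , p) λ (((a , b) , p) : ∃ P) → a , b , p)
         (searchA λ a → searchB λ b → P? (a , b))

module _ {V : Set} {E : Rel V 0ℓ} where

  star⇒walk : ∀ {x y} → Star E x y → ∃₂ λ n I → Walk E x y n I
  star⇒walk ε = 0 , [] , trivial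
  star⇒walk (e ◅ p) with star⇒walk p
  ... | zero , _ , trivial = 1 , [] , edge e
  ... | suc n , I , w = suc (suc n) , _ ∷ I , cons e w

  module _ (_≟_ : DecidableEquality V) (E? : Decidable E) (search : Searchable V) where

    HasWalk : V → V → ℕ → Set
    HasWalk x y n = ∃ (Walk E x y n)

    hasWalk? : ∀ x y n → Dec (HasWalk x y n)
    hasWalk? x y zero =
      mapDec (mk⇔ (λ { refl → [] , trivial }) λ { (_ , trivial) → refl }) (x ≟ y)
    hasWalk? x y 1 =
      mapDec (mk⇔ (λ e → [] , edge e) λ { (_ , edge e) → e }) (E? x y)
    hasWalk? x y (suc (suc n)) =
      mapDec (mk⇔ (λ { (z , e , I , w) → z ∷ I , cons e w }) λ { (_ , cons e w) → _ , e , _ , w })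
             (search {λ z → E x z × HasWalk z y (suc n)} λ z → E? x z ×-dec hasWalk? z y (suc n))

    shortestPath : ∀ {x y} → Star E x y → ∃₂ (ShortestPath E x y)
    shortestPath {x} {y} p
      with n , (I , w) , minimal ← least-witness (hasWalk? x y) (proj₂ (star⇒walk p))
      = n , I , w , λ m J w′ → minimal (J , w′)

    connected⇒[]-isTotalMutualVisibilitySet :
      (∀ x y → Star E x y) → IsTotalMutualVisibilitySet E []
    connected⇒[]-isTotalMutualVisibilitySet connected x y
      with n , I , sp ← shortestPath (connected x y)
      = n , I , sp , universal (λ _ ()) I

  record UniqueMidpoint (x v y : V) : Set where
    field
      left       : E x v
      right      : E v y
      ends-≢     : x ≢ y
      ends-¬adj  : ¬ E x y
      midpoint-≡ : ∀ {z} → E x z → E z y → z ≡ v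

  uniqueMidpoint⇒¬visible : ∀ {X x v y} → UniqueMidpoint x v y → v ∈ X → ¬ Visible E X x y
  uniqueMidpoint⇒¬visible {X} {x} {v} {y} m v∈X (_ , _ , (w , minimal) , I∉X) =
    throughMidpoint w (minimal 2 (v ∷ []) (cons left (edge right))) I∉X
    where
    open UniqueMidpoint m
    throughMidpoint : ∀ {n I} → Walk E x y n I → n ≤ 2 → ¬ All (λ u → ¬ u ∈ X) I
    throughMidpoint trivial _ _ = ends-≢ refl
    throughMidpoint (edge e) _ _ = ends-¬adj e
    throughMidpoint (cons e (edge e′)) _ (z∉X ∷ []) =
      z∉X (subst (_∈ X) (sym (midpoint-≡ e e′)) v∈X)
    throughMidpoint (cons _ (cons _ _)) (s≤s (s≤s ())) _

  uniqueMidpoints⇒MuT≡0 : IsTotalMutualVisibilitySet E [] →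
                          (∀ v → ∃₂ λ x y → UniqueMidpoint x v y) → MuT≡ E 0
  uniqueMidpoints⇒MuT≡0 []-visible midpoints = ([] , [] , []-visible , refl) , λ where
    [] _ _ → z≤n
    (v ∷ X) _ visible → let x , y , m = midpoints v in
      ⊥-elim (uniqueMidpoint⇒¬visible m (here refl) (visible x y))

flipAt : ∀ {n} → Vec Bool n → Fin n → Vec Bool n
flipAt x i = updateAt x i not

flipAt-involutive : ∀ {n} (x : Vec Bool n) i → flipAt (flipAt x i) i ≡ x
flipAt-involutive x i = trans (updateAt-updateAt i x) (updateAt-id-local i x (not-involutive _))

flipAt-≢ : ∀ {n} (x : Vec Bool n) i → x ≢ flipAt x i
flipAt-≢ x i eq = not-¬ refl (trans (cong (λ y → lookup y i) eq) (lookup∘updateAt i x))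

flipAt-flipAt-≢ : ∀ {n} {i j : Fin n} (x : Vec Bool n) → i ≢ j → x ≢ flipAt (flipAt x i) j
flipAt-flipAt-≢ {i = i} {j} x i≢j eq = not-¬ refl (begin
  lookup x i                           ≡⟨ cong (λ y → lookup y i) eq ⟩
  lookup (flipAt (flipAt x i) j) i     ≡⟨ lookup∘updateAt′ i j i≢j (flipAt x i) ⟩
  lookup (flipAt x i) i                ≡⟨ lookup∘updateAt i x ⟩
  not (lookup x i)                     ∎)
  where open ≡-Reasoning

data HypercubeAdj {n} : Rel (Vec Bool n) 0ℓ where
  flipAt-adj : ∀ {x} i → HypercubeAdj x (flipAt x i)

hypercube-connected : ∀ {n} (x y : Vec Bool n) → Star HypercubeAdj x y
hypercube-connected [] [] = ε
hypercube-connected (b ∷ x) (c ∷ y) =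
  gmap (b ∷_) (λ { (flipAt-adj i) → flipAt-adj (fsuc i) }) (hypercube-connected x y) ◅◅ setHead b c
  where
  setHead : ∀ b c → Star HypercubeAdj (b ∷ y) (c ∷ y)
  setHead true  true  = ε
  setHead false false = ε
  setHead true  false = flipAt-adj fzero ◅ ε
  setHead false true  = flipAt-adj fzero ◅ ε

successor : ∀ {n} (ℓ : Fin (suc n)) → ∃ (SuccMod (suc n) ℓ)
successor {n} ℓ with suc (toℕ ℓ) <? suc n
... | yes ℓ+1<d = fromℕ< ℓ+1<d , inj₁ (toℕ-fromℕ< ℓ+1<d)
... | no ℓ+1≮d = fzero , inj₂ (≤-antisym (toℕ<n ℓ) (≮⇒≥ ℓ+1≮d) , refl)

SuccMod⇒≢ : ∀ {n} {ℓ ℓ′ : Fin (suc (suc n))} → SuccMod (suc (suc n)) ℓ ℓ′ → ℓ′ ≢ ℓ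
SuccMod⇒≢ (inj₁ ℓ′≡ℓ+1) refl = 1+n≢n (sym ℓ′≡ℓ+1)
SuccMod⇒≢ (inj₂ (ℓ+1≡d , ℓ′≡0)) refl with () ← trans (cong suc (sym ℓ′≡0)) ℓ+1≡d

SuccMod? : ∀ d → Decidable (SuccMod d)
SuccMod? d ℓ ℓ′ = (toℕ ℓ′ ≟ℕ suc (toℕ ℓ)) ⊎-dec ((suc (toℕ ℓ) ≟ℕ d) ×-dec (toℕ ℓ′ ≟ℕ 0))

levels-from-zero : ∀ {n} (ℓ : Fin (suc n)) → Star (SuccMod (suc n)) fzero ℓ
levels-from-zero = <-weakInduction (Star (SuccMod _) fzero) ε
  λ i path → path ◅◅ inj₁ (cong suc (sym (toℕ-inject₁ i))) ◅ ε

module _ {d : ℕ} where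

  CCCAdj⇔ : ∀ {ℓ ℓ′ x x′} → CCCAdj d (ℓ , x) (ℓ′ , x′) ⇔
            ((x′ ≡ x × (SuccMod d ℓ ℓ′ ⊎ SuccMod d ℓ′ ℓ)) ⊎ (ℓ′ ≡ ℓ × x′ ≡ flipAt x ℓ))
  CCCAdj⇔ = mk⇔
    (λ { (cyc+ s) → inj₁ (refl , inj₁ s)
       ; (cyc- s) → inj₁ (refl , inj₂ s)
       ; cube     → inj₂ (refl , refl) })
    (λ { (inj₁ (refl , inj₁ s)) → cyc+ s
       ; (inj₁ (refl , inj₂ s)) → cyc- s
       ; (inj₂ (refl , refl))   → cube })

  CCCAdj? : Decidable (CCCAdj d)
  CCCAdj? (ℓ , x) (ℓ′ , x′) = mapDec (⇔-sym CCCAdj⇔)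
    ((≡-decVec _≟Bool_ x′ x ×-dec (SuccMod? d ℓ ℓ′ ⊎-dec SuccMod? d ℓ′ ℓ))
      ⊎-dec ((ℓ′ ≟Fin ℓ) ×-dec ≡-decVec _≟Bool_ x′ (flipAt x ℓ)))

  CCCAdj-sym : Sym (CCCAdj d) (CCCAdj d)
  CCCAdj-sym (cyc+ s) = cyc- s
  CCCAdj-sym (cyc- s) = cyc+ s
  CCCAdj-sym (cube {ℓ} {x}) =
    subst (λ y → CCCAdj d (ℓ , flipAt x ℓ) (ℓ , y)) (flipAt-involutive x ℓ) cube

  _≟CCC_ : DecidableEquality (CCCVertex d)
  _≟CCC_ = ≡-dec× _≟Fin_ (≡-decVec _≟Bool_)

  CCC-searchable : Searchable (CCCVertex d)
  CCC-searchable = ×-searchable Fin-searchable (Vec-searchable Bool-searchable)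

module _ {n : ℕ} where

  private
    E : Rel (CCCVertex (suc n)) 0ℓ
    E = CCCAdj (suc n)

  to-level : ∀ ℓ x → Star E (fzero , x) (ℓ , x)
  to-level ℓ x = gmap (_, x) cyc+ (levels-from-zero ℓ)

  from-level : ∀ ℓ x → Star E (ℓ , x) (fzero , x)
  from-level ℓ x = reverse CCCAdj-sym (to-level ℓ x)

  CCC-connected : ∀ u v → Star E u v
  CCC-connected (ℓ , x) (ℓ′ , y) =
    from-level ℓ x ◅◅ kleisliStar (fzero ,_) flipVia (hypercube-connected x y) ◅◅ to-level ℓ′ y
    where
    flipVia : ∀ {x y} → HypercubeAdj x y → Star E (fzero , x) (fzero , y)
    flipVia (flipAt-adj {x} i) = to-level i x ◅◅ cube ◅ from-level i (flipAt x i)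

module _ {n : ℕ} where

  private
    E : Rel (CCCVertex (suc (suc n))) 0ℓ
    E = CCCAdj (suc (suc n))

  CCC-uniqueMidpoint : ∀ {ℓ ℓ′} x → SuccMod (suc (suc n)) ℓ ℓ′ →
                       UniqueMidpoint {E = E} (ℓ , flipAt x ℓ) (ℓ , x) (ℓ′ , x)
  CCC-uniqueMidpoint {ℓ} {ℓ′} x s = record
    { left       = CCCAdj-sym cube
    ; right      = cyc+ s
    ; ends-≢     = λ eq → flipAt-≢ x ℓ (sym (cong proj₂ eq))
    ; ends-¬adj  = ends-¬adj ∘ Equivalence.to CCCAdj⇔
    ; midpoint-≡ = λ e e′ → midpoint-≡ (Equivalence.to CCCAdj⇔ e) (Equivalence.to CCCAdj⇔ e′)
    }
    where
    ℓ′≢ℓ : ℓ′ ≢ ℓ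
    ℓ′≢ℓ = SuccMod⇒≢ s

    ends-¬adj : ¬ ((x ≡ flipAt x ℓ × _) ⊎ (ℓ′ ≡ ℓ × _))
    ends-¬adj (inj₁ (x≡x⊕ℓ , _)) = flipAt-≢ x ℓ x≡x⊕ℓ
    ends-¬adj (inj₂ (ℓ′≡ℓ , _)) = ℓ′≢ℓ ℓ′≡ℓ

    midpoint-≡ : ∀ {ℓz xz} →
      (xz ≡ flipAt x ℓ × _) ⊎ (ℓz ≡ ℓ × xz ≡ flipAt (flipAt x ℓ) ℓ) →
      (x ≡ xz × _) ⊎ (ℓ′ ≡ ℓz × x ≡ flipAt xz ℓz) →
      (ℓz , xz) ≡ (ℓ , x)
    midpoint-≡ (inj₂ (refl , refl)) _ = cong (ℓ ,_) (flipAt-involutive x ℓ)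
    midpoint-≡ (inj₁ (refl , _)) (inj₁ (x≡x⊕ℓ , _)) = ⊥-elim (flipAt-≢ x ℓ x≡x⊕ℓ)
    midpoint-≡ (inj₁ (refl , _)) (inj₂ (refl , x≡x⊕ℓ⊕ℓ′)) =
      ⊥-elim (flipAt-flipAt-≢ x (ℓ′≢ℓ ∘ sym) x≡x⊕ℓ⊕ℓ′)

  CCC-MuT≡0 : MuT≡ E 0
  CCC-MuT≡0 = uniqueMidpoints⇒MuT≡0
    (connected⇒[]-isTotalMutualVisibilitySet _≟CCC_ CCCAdj? CCC-searchable CCC-connected)
    λ (ℓ , x) → let ℓ′ , s = successor ℓ in _ , _ , CCC-uniqueMidpoint x s

corollary5 : ∀ d → 3 ≤ d → MuT≡ (CCCAdj d) 0
corollary5 (suc zero) (s≤s ())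
corollary5 (suc (suc n)) _ = CCC-MuT≡0
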